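{- Let $X$ and $Y$ be nonempty rectangular arrays over a finite alphabet $\Sigma$ that have the same number of rows or the same number of columns. In the former case let $\circ$ denote horizontal concatenation $\mathrm{hcat}$; in the latter case let $\circ$ denote vertical concatenation $\mathrm{vcat}$ (concatenations are evaluated left to right). Suppose that $$X \circ W_1 \circ W_2 \circ \cdots \circ W_i = Y \circ Z_1 \circ Z_2 \circ \cdots \circ Z_j$$ holds for some integers $i, j \ge 0$ and arrays $W_1,\dots,W_i, Z_1,\dots,Z_j \in \{X, Y\}$. Then $X$ and $Y$ are powers of a third array $T$, i.e., there exist a nonempty array $T$ and positive integers $p_1,q_1,p_2,q_2$ with $X = T^{p_1\times q_1}$ and $Y = T^{p_2\times q_2}$.
   Context: $\Sigma^{m\times n}$ denotes the set of $m\times n$ rectangular arrays with entries in $\Sigma$, indexed from $0$. For $A\in\Sigma^{m\times n}$ and positive integers $p,q$, $A^{p\times q}$ is the $pm \times qn$ array $B$ with $B[i,j] = A[i \bmod m, j \bmod n]$. If $A$ is $m\times n_1$ and $B$ is $m \times n_2$, $\mathrm{hcat}(A,B)$ is the $m\times(n_1+n_2)$ array obtained by placing $B$ to the right of $A$. If $A$ is $m_1\times n$ and $B$ is $m_2\times n$, $\mathrm{vcat}(A,B)$ is the $(m_1+m_2)\times n$ array obtained by placing $B$ underneath $A$. -}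

module Defs where

open import Data.Nat using (ℕ; suc; _+_; _*_; _%_)
open import Data.Nat using (_≤_)
open import Data.Nat.DivMod using (m%n<n)
open import Data.Product using (_×_)
open import Relation.Binary.PropositionalEquality using (_≡_)
open import Data.Fin using (Fin; toℕ; fromℕ<)
open import Data.Vec using (Vec; zipWith; _++_; lookup; tabulate)
open import Data.List using (List; foldl; map)
open import Data.Bool using (Bool; if_then_else_)
open import Data.Product using (Σ; _,_)

-- An array in Σ^{m×n} is represented as  Vec (Vec A n) m  (m rows, each of length n),
-- so that entry [i,j] is  lookup (lookup X i) j.

record Array (A : Set) : Set where
  constructor arr
  field
    rows    : ℕ
    cols    : ℕ
    entries : Vec (Vec A cols) rows

HArr : Set → ℕ → Set
HArr A m = Σ ℕ (λ k → Vec (Vec A k) m)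

VArr : Set → ℕ → Set
VArr A n = Σ ℕ (λ k → Vec (Vec A n) k)

hcat : {A : Set} {m : ℕ} → HArr A m → HArr A m → HArr A m
hcat (k , x) (l , y) = k + l , zipWith _++_ x y

vcat : {A : Set} {n : ℕ} → VArr A n → VArr A n → VArr A n
vcat (k , x) (l , y) = k + l , x ++ y

hcats : {A : Set} {m : ℕ} → HArr A m → List (HArr A m) → HArr A m
hcats = foldl hcat

vcats : {A : Set} {n : ℕ} → VArr A n → List (VArr A n) → VArr A n
vcats = foldl vcat

pick : {B : Set} → B → B → Bool → B
pick x y b = if b then x else y

-- Power T^{p×q} of a nonempty (suc a)×(suc b) array T:
-- the (p*(suc a))×(q*(suc b)) array B with B[i,j] = T[i mod (suc a), j mod (suc b)].
power : {A : Set} {a b : ℕ} → Vec (Vec A (suc b)) (suc a) → (p q : ℕ)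
      → Vec (Vec A (q * suc b)) (p * suc a)
power {a = a} {b = b} T p q =
  tabulate λ i → tabulate λ j →
    lookup (lookup T (fromℕ< (m%n<n (toℕ i) (suc a)))) (fromℕ< (m%n<n (toℕ j) (suc b)))

CommonRoot : {A : Set} → Array A → Array A → Set
CommonRoot {A} X Y =
  Σ ℕ λ a → Σ ℕ λ b → Σ (Vec (Vec A (suc b)) (suc a)) λ T →
  Σ ℕ λ p₁ → Σ ℕ λ q₁ → Σ ℕ λ p₂ → Σ ℕ λ q₂ →
    (1 ≤ p₁) × (1 ≤ q₁) × (1 ≤ p₂) × (1 ≤ q₂) ×
    (X ≡ arr (p₁ * suc a) (q₁ * suc b) (power T p₁ q₁)) ×
    (Y ≡ arr (p₂ * suc a) (q₂ * suc b) (power T p₂ q₂))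

module Submission where

-- Read an array with m rows as the word of its columns (for hcat), or an array
-- with n columns as the word of its rows (for vcat).  These readings turn concatenation of
-- arrays into concatenation of words, so the equation becomes a word equation
--   x u = y v   with   u, v ∈ {x, y}*,
-- and the defect theorem for two words says that then x = t^p and y = t^q for a nonempty
-- word t.  We prove it by induction on |x| + |y|: comparing prefixes, say y = x y', and
-- cancelling x turns the equation into one of the same shape for the shorter pair (x, y').
-- Finally a word t^p of columns (rows) is the array power T^{1×p} (T^{p×1}) of the array T
-- whose columns (rows) are the letters of t, since position j of t^p is position j mod |t|
-- of t.

open import Defs
open import Data.Nat using (ℕ; zero; suc; _+_; _*_; _≤_; _<_; z≤n; s≤s; s≤s⁻¹; _%_)
open import Data.Nat.Properties
  using (≤-refl; ≤-trans; m≤m+n; +-comm; +-cancelˡ-<; +-monoʳ-<; m<n+m; <-≤-trans;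
         <-≤-connex; m≤n⇒∃[o]m+o≡n; *-identityˡ)
open import Data.Nat.DivMod using (_mod_; m%n<n; m<n⇒m%n≡m; [m+n]%n≡m%n)
open import Data.Fin using (Fin; zero; suc; toℕ)
open import Data.Fin.Properties using (toℕ-fromℕ<; fromℕ<-toℕ; fromℕ<-cong; toℕ<n)
open import Data.List using (List; []; _∷_; _++_; length; concat; map; foldl)
open import Data.List.Properties using (length-++; ++-assoc; ++-identityʳ; ∷-injective)
open import Data.Vec using (Vec; lookup; tabulate; toList; fromList; zipWith) renaming (_++_ to _++ᵛ_)
import Data.Vec as Vec
open import Data.Vec.Properties
  using (lookup-map; toList-++; length-toList; lookup∘tabulate; tabulate∘lookup; tabulate-cong)
open import Data.Maybe using (Maybe; just; nothing)
open import Data.Maybe.Properties using (just-injective)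
open import Data.Bool using (Bool; true; false)
open import Data.Product using (Σ; _×_; _,_)
open import Data.Sum using (_⊎_; inj₁; inj₂)
open import Function.Bundles using (_↔_)
open import Relation.Binary.PropositionalEquality
  using (_≡_; refl; sym; trans; cong; cong₂; subst; module ≡-Reasoning)

module _ {C : Set} where

  infixr 8 _^_

  _^_ : List C → ℕ → List C
  t ^ zero  = []
  t ^ suc p = t ++ t ^ p

  ^-+ : ∀ t p q → t ^ (p + q) ≡ t ^ p ++ t ^ q
  ^-+ t zero    q = refl
  ^-+ t (suc p) q = trans (cong (t ++_) (^-+ t p q)) (sym (++-assoc t (t ^ p) (t ^ q)))

  length-^ : ∀ t p → length (t ^ p) ≡ p * length t
  length-^ t zero    = refl
  length-^ t (suc p) = trans (length-++ t) (cong (length t +_) (length-^ t p))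

  record CommonPower (x y : List C) : Set where
    constructor commonPower
    field
      r      : C
      rs     : List C
      p q    : ℕ
      1≤p    : 1 ≤ p
      1≤q    : 1 ≤ q
      x≡r^p  : x ≡ (r ∷ rs) ^ p
      y≡r^q  : y ≡ (r ∷ rs) ^ q

  CommonPower-sym : ∀ {x y} → CommonPower x y → CommonPower y x
  CommonPower-sym (commonPower r rs p q 1≤p 1≤q ex ey) = commonPower r rs q p 1≤q 1≤p ey ex

  CommonPower-refl : ∀ x → 1 ≤ length x → CommonPower x x
  CommonPower-refl (r ∷ rs) _ = commonPower r rs 1 1 ≤-refl ≤-refl e e
    where e = sym (++-identityʳ (r ∷ rs))

  CommonPower-extend : ∀ {x y'} → CommonPower x y' → CommonPower x (x ++ y')
  CommonPower-extend {x} {y'} (commonPower r rs p q 1≤p 1≤q ex ey) =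
    commonPower r rs p (p + q) 1≤p (≤-trans 1≤p (m≤m+n p q)) ex
      (trans (cong₂ _++_ ex ey) (sym (^-+ (r ∷ rs) p q)))

  data Generated (x y : List C) : List C → Set where
    nil   : Generated x y []
    withˣ : ∀ {w} → Generated x y w → Generated x y (x ++ w)
    withʸ : ∀ {w} → Generated x y w → Generated x y (y ++ w)

  Generated-swap : ∀ {x y w} → Generated x y w → Generated y x w
  Generated-swap nil       = nil
  Generated-swap (withˣ g) = withʸ (Generated-swap g)
  Generated-swap (withʸ g) = withˣ (Generated-swap g)

  -- {x, x y'}* ⊆ {x, y'}*, since the generator x y' is itself a product of x and y'.
  Generated-shorten : ∀ {x y' w} → Generated x (x ++ y') w → Generated x y' w
  Generated-shorten nil       = nil
  Generated-shorten (withˣ g) = withˣ (Generated-shorten g)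
  Generated-shorten {x} {y'} (withʸ {w} g) =
    subst (Generated x y') (sym (++-assoc x y' w)) (withˣ (withʸ (Generated-shorten g)))

  prefix-cases : ∀ x y {u v} → x ++ u ≡ y ++ v →
    (Σ (List C) λ y' → y ≡ x ++ y' × u ≡ y' ++ v) ⊎
    (Σ (List C) λ x' → x ≡ y ++ x' × v ≡ x' ++ u)
  prefix-cases []      y       e = inj₁ (y , refl , e)
  prefix-cases (a ∷ x) []      e = inj₂ (a ∷ x , refl , sym e)
  prefix-cases (a ∷ x) (b ∷ y) e with ∷-injective e
  ... | refl , e′ with prefix-cases x y e′
  ...   | inj₁ (y' , y≡ , u≡) = inj₁ (y' , cong (a ∷_) y≡ , u≡)
  ...   | inj₂ (x' , x≡ , v≡) = inj₂ (x' , cong (a ∷_) x≡ , v≡)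

  cancel-prefix : ∀ {x c y' u v} → Generated x (x ++ c ∷ y') u → u ≡ (c ∷ y') ++ v →
    Σ (List C) λ u' → Generated x (c ∷ y') u' × x ++ u' ≡ (c ∷ y') ++ v
  cancel-prefix nil ()
  cancel-prefix (withˣ g) e = _ , Generated-shorten g , e
  cancel-prefix {x} {c} {y'} (withʸ {w} g) e =
    (c ∷ y') ++ w , withʸ (Generated-shorten g) , trans (sym (++-assoc x (c ∷ y') w)) e

  Defect : ℕ → Set
  Defect k = ∀ {x y u v} → length x + length y ≤ k → 1 ≤ length x → 1 ≤ length y →
    Generated x y u → Generated x y v → x ++ u ≡ y ++ v → CommonPower x y

  prefix-step : ∀ {k} → Defect k → ∀ {x y' u v} →
    length x + length (x ++ y') ≤ suc k → 1 ≤ length x →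
    Generated x (x ++ y') u → Generated x (x ++ y') v → u ≡ y' ++ v → CommonPower x (x ++ y')
  prefix-step ih {x} {[]} _ 1≤x _ _ _ =
    subst (CommonPower x) (sym (++-identityʳ x)) (CommonPower-refl x 1≤x)
  prefix-step {k} ih {x} {c ∷ y'} bound 1≤x gu gv u≡ with cancel-prefix gu u≡
  ... | u' , gu' , e = CommonPower-extend (ih shorter 1≤x (s≤s z≤n) gu' (Generated-shorten gv) e)
    where
    -- |x| + |y'| < |x| + (|x| + |y'|) = |x| + |x y'| ≤ k + 1, because x is nonempty.
    shorter : length x + length (c ∷ y') ≤ k
    shorter = s≤s⁻¹ (<-≤-trans (+-monoʳ-< (length x) (m<n+m _ 1≤x))
                               (subst (λ n → length x + n ≤ suc k) (length-++ x) bound))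

  defect : ∀ k → Defect k
  defect zero {x = []}    _  () _ _ _ _
  defect zero {x = _ ∷ _} () _  _ _ _ _
  defect (suc k) {x} {y} bound 1≤x 1≤y gu gv e with prefix-cases x y e
  ... | inj₁ (y' , refl , u≡) = prefix-step (defect k) bound 1≤x gu gv u≡
  ... | inj₂ (x' , refl , v≡) =
    CommonPower-sym (prefix-step (defect k) (subst (_≤ suc k) (+-comm _ (length y)) bound) 1≤y
                                 (Generated-swap gv) (Generated-swap gu) v≡)

  foldl-concat : {S : Set} (op : S → S → S) (w : S → List C) →
    (∀ s s' → w (op s s') ≡ w s ++ w s') →
    ∀ s ss → w (foldl op s ss) ≡ w s ++ concat (map w ss)
  foldl-concat op w hom s []       = sym (++-identityʳ (w s))
  foldl-concat op w hom s (s' ∷ ss) = begin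
    w (foldl op (op s s') ss)                  ≡⟨ foldl-concat op w hom (op s s') ss ⟩
    w (op s s') ++ concat (map w ss)           ≡⟨ cong (_++ concat (map w ss)) (hom s s') ⟩
    (w s ++ w s') ++ concat (map w ss)         ≡⟨ ++-assoc (w s) (w s') _ ⟩
    w s ++ concat (map w (s' ∷ ss))            ∎
    where open ≡-Reasoning

  Generated-picks : {S : Set} (w : S → List C) (X Y : S) (bs : List Bool) →
    Generated (w X) (w Y) (concat (map w (map (pick X Y) bs)))
  Generated-picks w X Y []          = nil
  Generated-picks w X Y (true ∷ bs)  = withˣ (Generated-picks w X Y bs)
  Generated-picks w X Y (false ∷ bs) = withʸ (Generated-picks w X Y bs)

  defect-along : {S : Set} (op : S → S → S) (w : S → List C) →
    (∀ s s' → w (op s s') ≡ w s ++ w s') → (X Y : S) →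
    1 ≤ length (w X) → 1 ≤ length (w Y) → (ws zs : List Bool) →
    foldl op X (map (pick X Y) ws) ≡ foldl op Y (map (pick X Y) zs) →
    CommonPower (w X) (w Y)
  defect-along op w hom X Y 1≤x 1≤y ws zs e =
    defect _ ≤-refl 1≤x 1≤y (Generated-picks w X Y ws) (Generated-picks w X Y zs) (begin
      w X ++ concat (map w (map (pick X Y) ws)) ≡⟨ sym (foldl-concat op w hom X (map (pick X Y) ws)) ⟩
      w (foldl op X (map (pick X Y) ws))        ≡⟨ cong w e ⟩
      w (foldl op Y (map (pick X Y) zs))        ≡⟨ foldl-concat op w hom Y (map (pick X Y) zs) ⟩
      w Y ++ concat (map w (map (pick X Y) zs)) ∎)
    where open ≡-Reasoning

  at : List C → ℕ → Maybe C
  at []      j       = nothing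
  at (c ∷ t) zero    = just c
  at (c ∷ t) (suc j) = at t j

  at-++ˡ : ∀ t s j → j < length t → at (t ++ s) j ≡ at t j
  at-++ˡ (c ∷ t) s zero    _       = refl
  at-++ˡ (c ∷ t) s (suc j) (s≤s j<) = at-++ˡ t s j j<

  at-++ʳ : ∀ t s j → at (t ++ s) (length t + j) ≡ at s j
  at-++ʳ []      s j = refl
  at-++ʳ (c ∷ t) s j = at-++ʳ t s j

  at-fromList : ∀ t (j : Fin (length t)) → at t (toℕ j) ≡ just (lookup (fromList t) j)
  at-fromList (c ∷ t) zero    = refl
  at-fromList (c ∷ t) (suc j) = at-fromList t j

  at-toList : ∀ {k} (v : Vec C k) (j : Fin k) → at (toList v) (toℕ j) ≡ just (lookup v j)
  at-toList (c Vec.∷ v) zero    = refl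
  at-toList (c Vec.∷ v) (suc j) = at-toList v j

  at-^ : ∀ c t p j → j < length ((c ∷ t) ^ p) → at ((c ∷ t) ^ p) j ≡ at (c ∷ t) (j % length (c ∷ t))
  at-^ c t zero    j ()
  at-^ c t (suc p) j j< with <-≤-connex j (length (c ∷ t))
  ... | inj₁ j<L = trans (at-++ˡ (c ∷ t) _ j j<L) (cong (at (c ∷ t)) (sym (m<n⇒m%n≡m j<L)))
  ... | inj₂ L≤j with m≤n⇒∃[o]m+o≡n L≤j
  ...   | j' , refl = begin
    at (c ∷ t ++ (c ∷ t) ^ p) (L + j')  ≡⟨ at-++ʳ (c ∷ t) _ j' ⟩
    at ((c ∷ t) ^ p) j'                 ≡⟨ at-^ c t p j' j'< ⟩
    at (c ∷ t) (j' % L)                 ≡⟨ cong (at (c ∷ t)) (sym (trans (cong (_% L) (+-comm L j')) ([m+n]%n≡m%n j' L))) ⟩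
    at (c ∷ t) ((L + j') % L)           ∎
    where
    open ≡-Reasoning
    L = length (c ∷ t)
    j'< : j' < length ((c ∷ t) ^ p)
    j'< = +-cancelˡ-< L _ _ (subst (L + j' <_) (length-++ (c ∷ t)) j<)

  vec-ext : ∀ {n} {u v : Vec C n} → (∀ i → lookup u i ≡ lookup v i) → u ≡ v
  vec-ext {u = u} {v} p = trans (sym (tabulate∘lookup u)) (trans (tabulate-cong p) (tabulate∘lookup v))

  nonempty-toList : ∀ {k} (v : Vec C k) → 1 ≤ k → 1 ≤ length (toList v)
  nonempty-toList v 1≤k = subst (1 ≤_) (sym (length-toList v)) 1≤k

  length-periodic : ∀ {k} (v : Vec C k) c t p → toList v ≡ (c ∷ t) ^ p → k ≡ p * length (c ∷ t)
  length-periodic v c t p ev = trans (sym (length-toList v)) (trans (cong length ev) (length-^ (c ∷ t) p))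

  lookup-periodic : ∀ {k} (v : Vec C k) c t p → toList v ≡ (c ∷ t) ^ p →
    ∀ j → lookup v j ≡ lookup (fromList (c ∷ t)) (toℕ j mod length (c ∷ t))
  lookup-periodic v c t p ev j = just-injective (begin
    just (lookup v j)                                      ≡⟨ sym (at-toList v j) ⟩
    at (toList v) (toℕ j)                                  ≡⟨ cong (λ w → at w (toℕ j)) ev ⟩
    at ((c ∷ t) ^ p) (toℕ j)                               ≡⟨ at-^ c t p (toℕ j) j< ⟩
    at (c ∷ t) (toℕ j % length (c ∷ t))                    ≡⟨ cong (at (c ∷ t)) (sym (toℕ-fromℕ< (m%n<n (toℕ j) (length (c ∷ t))))) ⟩
    at (c ∷ t) (toℕ (toℕ j mod length (c ∷ t)))            ≡⟨ at-fromList (c ∷ t) (toℕ j mod length (c ∷ t)) ⟩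
    just (lookup (fromList (c ∷ t)) (toℕ j mod length (c ∷ t))) ∎)
    where
    open ≡-Reasoning
    j< : toℕ j < length ((c ∷ t) ^ p)
    j< = subst (toℕ j <_) (trans (sym (length-toList v)) (cong length ev)) (toℕ<n j)

module _ {A : Set} where

  columns : ∀ {k m} → Vec (Vec A k) m → Vec (Vec A m) k
  columns {zero}  X = Vec.[]
  columns {suc k} X = Vec.map Vec.head X Vec.∷ columns (Vec.map Vec.tail X)

  lookup-columns : ∀ {k m} (X : Vec (Vec A k) m) i j → lookup (lookup (columns X) j) i ≡ lookup (lookup X i) j
  lookup-columns {suc k} X i zero    = trans (lookup-map i Vec.head X) (head-lookup (lookup X i))
    where
    head-lookup : ∀ {n} (r : Vec A (suc n)) → Vec.head r ≡ lookup r zero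
    head-lookup (a Vec.∷ r) = refl
  lookup-columns {suc k} X i (suc j) =
    trans (lookup-columns (Vec.map Vec.tail X) i j)
          (trans (cong (λ r → lookup r j) (lookup-map i Vec.tail X)) (tail-lookup (lookup X i)))
    where
    tail-lookup : (r : Vec A (suc k)) → lookup (Vec.tail r) j ≡ lookup r (suc j)
    tail-lookup (a Vec.∷ r) = refl

  columns-hcat : ∀ {m k l} (X : Vec (Vec A k) m) (Y : Vec (Vec A l) m) →
    columns (zipWith _++ᵛ_ X Y) ≡ columns X ++ᵛ columns Y
  columns-hcat {k = zero}  X Y = cong columns (hcat-empty X Y)
    where
    hcat-empty : ∀ {m l} (X : Vec (Vec A 0) m) (Y : Vec (Vec A l) m) → zipWith _++ᵛ_ X Y ≡ Y
    hcat-empty Vec.[]              Vec.[]       = refl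
    hcat-empty (Vec.[] Vec.∷ X) (y Vec.∷ Y) = cong (y Vec.∷_) (hcat-empty X Y)
  columns-hcat {k = suc k} X Y =
    cong₂ Vec._∷_ (heads X Y) (trans (cong columns (tails X Y)) (columns-hcat (Vec.map Vec.tail X) Y))
    where
    heads : ∀ {m l} (X : Vec (Vec A (suc k)) m) (Y : Vec (Vec A l) m) →
      Vec.map Vec.head (zipWith _++ᵛ_ X Y) ≡ Vec.map Vec.head X
    heads Vec.[]                   Vec.[]       = refl
    heads ((a Vec.∷ x) Vec.∷ X) (y Vec.∷ Y) = cong (a Vec.∷_) (heads X Y)
    tails : ∀ {m l} (X : Vec (Vec A (suc k)) m) (Y : Vec (Vec A l) m) →
      Vec.map Vec.tail (zipWith _++ᵛ_ X Y) ≡ zipWith _++ᵛ_ (Vec.map Vec.tail X) Y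
    tails Vec.[]                   Vec.[]       = refl
    tails ((a Vec.∷ x) Vec.∷ X) (y Vec.∷ Y) = cong ((x ++ᵛ y) Vec.∷_) (tails X Y)

  columnWord : ∀ {m} → HArr A m → List (Vec A m)
  columnWord (k , X) = toList (columns X)

  columnWord-hcat : ∀ {m} (X Y : HArr A m) → columnWord (hcat X Y) ≡ columnWord X ++ columnWord Y
  columnWord-hcat (k , X) (l , Y) = trans (cong toList (columns-hcat X Y)) (toList-++ (columns X) (columns Y))

  rowWord : ∀ {n} → VArr A n → List (Vec A n)
  rowWord (k , X) = toList X

  rowWord-vcat : ∀ {n} (X Y : VArr A n) → rowWord (vcat X Y) ≡ rowWord X ++ rowWord Y
  rowWord-vcat (k , X) (l , Y) = toList-++ X Y

  lookup-power : ∀ {a b} (T : Vec (Vec A (suc b)) (suc a)) p q i j →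
    lookup (lookup (power T p q) i) j ≡ lookup (lookup T (toℕ i mod suc a)) (toℕ j mod suc b)
  lookup-power T p q i j = trans (cong (λ r → lookup r j) (lookup∘tabulate _ i)) (lookup∘tabulate _ j)

  power-from-entries : ∀ {r c a b} (M : Vec (Vec A c) r) (T : Vec (Vec A (suc b)) (suc a)) p q →
    r ≡ p * suc a → c ≡ q * suc b →
    (∀ i j → lookup (lookup M i) j ≡ lookup (lookup T (toℕ i mod suc a)) (toℕ j mod suc b)) →
    arr r c M ≡ arr (p * suc a) (q * suc b) (power T p q)
  power-from-entries M T p q refl refl entries =
    cong (arr _ _) (vec-ext λ i → vec-ext λ j → trans (entries i j) (sym (lookup-power T p q i j)))

  mod-toℕ : ∀ {n} (i : Fin (suc n)) → toℕ i mod suc n ≡ i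
  mod-toℕ i = trans (fromℕ<-cong _ _ (m<n⇒m%n≡m (toℕ<n i)) _ (toℕ<n i)) (fromℕ<-toℕ i (toℕ<n i))

  columns-power : ∀ {m k} (X : Vec (Vec A k) (suc m)) c t p → toList (columns X) ≡ (c ∷ t) ^ p →
    arr (suc m) k X ≡ arr (1 * suc m) (p * length (c ∷ t)) (power (columns (fromList (c ∷ t))) 1 p)
  columns-power {m} X c t p ev =
    power-from-entries X (columns R) 1 p (sym (*-identityˡ (suc m))) (length-periodic (columns X) c t p ev)
      λ i j → begin
        lookup (lookup X i) j                              ≡⟨ sym (lookup-columns X i j) ⟩
        lookup (lookup (columns X) j) i                    ≡⟨ cong (λ col → lookup col i) (lookup-periodic (columns X) c t p ev j) ⟩
        lookup (lookup R (toℕ j mod L)) i                  ≡⟨ cong (lookup (lookup R (toℕ j mod L))) (sym (mod-toℕ i)) ⟩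
        lookup (lookup R (toℕ j mod L)) (toℕ i mod suc m)  ≡⟨ sym (lookup-columns R (toℕ j mod L) (toℕ i mod suc m)) ⟩
        lookup (lookup (columns R) (toℕ i mod suc m)) (toℕ j mod L) ∎
    where
    open ≡-Reasoning
    R = fromList (c ∷ t)
    L = length (c ∷ t)

  rows-power : ∀ {n k} (X : Vec (Vec A (suc n)) k) c t p → toList X ≡ (c ∷ t) ^ p →
    arr k (suc n) X ≡ arr (p * length (c ∷ t)) (1 * suc n) (power (fromList (c ∷ t)) p 1)
  rows-power {n} X c t p ev =
    power-from-entries X R p 1 (length-periodic X c t p ev) (sym (*-identityˡ (suc n)))
      λ i j → begin
        lookup (lookup X i) j                              ≡⟨ cong (λ row → lookup row j) (lookup-periodic X c t p ev i) ⟩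
        lookup (lookup R (toℕ i mod L)) j                  ≡⟨ cong (lookup (lookup R (toℕ i mod L))) (sym (mod-toℕ j)) ⟩
        lookup (lookup R (toℕ i mod L)) (toℕ j mod suc n)  ∎
    where
    open ≡-Reasoning
    R = fromList (c ∷ t)
    L = length (c ∷ t)

  columns-root : ∀ {m k l} (X : Vec (Vec A k) (suc m)) (Y : Vec (Vec A l) (suc m)) →
    CommonPower (toList (columns X)) (toList (columns Y)) → CommonRoot (arr (suc m) k X) (arr (suc m) l Y)
  columns-root {m} X Y (commonPower c t p q 1≤p 1≤q eX eY) =
    m , length t , columns (fromList (c ∷ t)) , 1 , p , 1 , q , ≤-refl , 1≤p , ≤-refl , 1≤q ,
    columns-power X c t p eX , columns-power Y c t q eY

  rows-root : ∀ {n k l} (X : Vec (Vec A (suc n)) k) (Y : Vec (Vec A (suc n)) l) →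
    CommonPower (toList X) (toList Y) → CommonRoot (arr k (suc n) X) (arr l (suc n) Y)
  rows-root {n} X Y (commonPower c t p q 1≤p 1≤q eX eY) =
    length t , n , fromList (c ∷ t) , p , 1 , q , 1 , 1≤p , ≤-refl , 1≤q , ≤-refl ,
    rows-power X c t p eX , rows-power Y c t q eY

hcat-common-root : {A : Set} (m n₁ n₂ : ℕ) (X : Vec (Vec A n₁) m) (Y : Vec (Vec A n₂) m) →
  1 ≤ m → 1 ≤ n₁ → 1 ≤ n₂ → (ws zs : List Bool) →
  hcats (n₁ , X) (map (pick (n₁ , X) (n₂ , Y)) ws) ≡ hcats (n₂ , Y) (map (pick (n₁ , X) (n₂ , Y)) zs) →
  CommonRoot (arr m n₁ X) (arr m n₂ Y)
hcat-common-root (suc m) n₁ n₂ X Y (s≤s z≤n) 1≤n₁ 1≤n₂ ws zs e =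
  columns-root X Y (defect-along hcat columnWord columnWord-hcat (n₁ , X) (n₂ , Y)
                      (nonempty-toList (columns X) 1≤n₁) (nonempty-toList (columns Y) 1≤n₂) ws zs e)

vcat-common-root : {A : Set} (n m₁ m₂ : ℕ) (X : Vec (Vec A n) m₁) (Y : Vec (Vec A n) m₂) →
  1 ≤ n → 1 ≤ m₁ → 1 ≤ m₂ → (ws zs : List Bool) →
  vcats (m₁ , X) (map (pick (m₁ , X) (m₂ , Y)) ws) ≡ vcats (m₂ , Y) (map (pick (m₁ , X) (m₂ , Y)) zs) →
  CommonRoot (arr m₁ n X) (arr m₂ n Y)
vcat-common-root (suc n) m₁ m₂ X Y (s≤s z≤n) 1≤m₁ 1≤m₂ ws zs e =
  rows-root X Y (defect-along vcat rowWord rowWord-vcat (m₁ , X) (m₂ , Y)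
                   (nonempty-toList X 1≤m₁) (nonempty-toList Y 1≤m₂) ws zs e)

lemma5 : {A : Set} → Σ ℕ (λ s → A ↔ Fin s) →
  ((m n₁ n₂ : ℕ) (X : Vec (Vec A n₁) m) (Y : Vec (Vec A n₂) m) →
    1 ≤ m → 1 ≤ n₁ → 1 ≤ n₂ →
    (ws zs : List Bool) →
    hcats (n₁ , X) (map (pick (n₁ , X) (n₂ , Y)) ws)
      ≡ hcats (n₂ , Y) (map (pick (n₁ , X) (n₂ , Y)) zs) →
    CommonRoot (arr m n₁ X) (arr m n₂ Y))
  ×
  ((n m₁ m₂ : ℕ) (X : Vec (Vec A n) m₁) (Y : Vec (Vec A n) m₂) →
    1 ≤ n → 1 ≤ m₁ → 1 ≤ m₂ →
    (ws zs : List Bool) →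
    vcats (m₁ , X) (map (pick (m₁ , X) (m₂ , Y)) ws)
      ≡ vcats (m₂ , Y) (map (pick (m₁ , X) (m₂ , Y)) zs) →
    CommonRoot (arr m₁ n X) (arr m₂ n Y))
lemma5 _ = hcat-common-root , vcat-common-root
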